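{- For all integers $k\ge 0$ and $n$, $$p^{(1)}_k(n,2)=\sum_{i=0}^{k}(-1)^i\, p^{(1)}_{k-i}(n-i).$$ That is, the number of partitions of $n$ into exactly $k$ distinct positive parts, all of which are at least $2$, equals the alternating sum over $0\le i\le k$ of the numbers of partitions of $n-i$ into exactly $k-i$ distinct positive parts.
   Context: A partition of an integer $m$ into $k$ parts is a weakly decreasing sequence of $k$ positive integers summing to $m$. For a nonnegative integer $d$, the parts are called $d$-distant if any two parts differ by at least $d$ (so $1$-distant means the parts are distinct). $p^{(d)}_k(m)$ denotes the number of partitions of $m$ into exactly $k$ $d$-distant parts, and $p^{(d)}_k(m,r)$ denotes the number of such partitions whose smallest part is at least $r$. Conventions: $p^{(d)}_0(m)=p^{(d)}_0(m,r)=1$ if $m=0$ and $0$ otherwise; all these counts are $0$ when $m<0$. -}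

module Defs where

open import Data.Nat using (ℕ; zero; suc; _+_; _∸_; _≤_; _<_; _≤?_)
import Data.Nat.Properties as ℕP
open import Data.Integer as ℤ using (ℤ; +_; -[1+_])
open import Data.Fin using (Fin) renaming (_<_ to _<ᶠ_)
import Data.Fin.Properties as FinP
open import Data.Vec using (Vec; []; _∷_; lookup)
import Data.Vec as Vec
open import Data.List using (List; []; _∷_; length; filter; upTo; cartesianProductWith)
open import Data.Product using (_×_; _,_)
open import Relation.Nullary using (Dec; yes; no)
open import Relation.Nullary.Decidable using (_×-dec_; _→-dec_)
open import Relation.Binary.PropositionalEquality using (_≡_)

IsDistantPartition : (d r m k : ℕ) → Vec ℕ k → Set
IsDistantPartition d r m k v =
  (∀ (i j : Fin k) → i <ᶠ j → lookup v j ≤ lookup v i) ×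
  (∀ (i : Fin k) → 1 ≤ lookup v i) ×
  (∀ (i : Fin k) → r ≤ lookup v i) ×
  (∀ (i j : Fin k) → i <ᶠ j → lookup v j + d ≤ lookup v i) ×
  (Vec.sum v ≡ m)

isDistantPartition? : (d r m k : ℕ) → (v : Vec ℕ k) → Dec (IsDistantPartition d r m k v)
isDistantPartition? d r m k v =
  FinP.all? (λ i → FinP.all? (λ j → (i FinP.<? j) →-dec (lookup v j ≤? lookup v i))) ×-dec
  (FinP.all? (λ i → 1 ≤? lookup v i) ×-dec
  (FinP.all? (λ i → r ≤? lookup v i) ×-dec
  (FinP.all? (λ i → FinP.all? (λ j → (i FinP.<? j) →-dec (lookup v j + d ≤? lookup v i))) ×-dec
  (Vec.sum v ℕP.≟ m))))

-- All vectors of length k with entries in {0, …, m}.  Every partition of m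
-- has all its parts ≤ m, so this list contains every candidate exactly once.
boundedVecs : (m k : ℕ) → List (Vec ℕ k)
boundedVecs m zero    = [] ∷ []
boundedVecs m (suc k) = cartesianProductWith _∷_ (upTo (suc m)) (boundedVecs m k)

-- p^{(d)}_k(m, r) for natural m : number of partitions of m into exactly k
-- d-distant parts with smallest part ≥ r.
pℕ : (d k m r : ℕ) → ℕ
pℕ d k m r = length (filter (isDistantPartition? d r m k) (boundedVecs m k))

pr : (d k : ℕ) → ℤ → (r : ℕ) → ℕ
pr d k (+ m)      r = pℕ d k m r
pr d k -[1+ _ ]   r = 0

-- p^{(d)}_k(m) : no restriction on the smallest part (r = 0; parts are positive anyway).
p : (d k : ℕ) → ℤ → ℕ
p d k m = pr d k m 0

sign : ℕ → ℤ
sign zero    = ℤ.+ 1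
sign (suc i) = ℤ.- sign i

Σ[0≤i≤_] : ℕ → (ℕ → ℤ) → ℤ
Σ[0≤i≤ zero ] f  = f 0
Σ[0≤i≤ suc n ] f = Σ[0≤i≤ n ] f ℤ.+ f (suc n)

-- For r ≥ 1, deleting the smallest part r of a partition of n into k + 1 d-distant parts ≥ r leaves a
-- partition of n − r into k parts ≥ r + d, and conversely; hence
--   p⁽ᵈ⁾ₖ₊₁(n, r) = p⁽ᵈ⁾ₖ₊₁(n, r + 1) + p⁽ᵈ⁾ₖ(n − r, r + d).
-- For d = r = 1 this is p⁽¹⁾ₖ₊₁(n) = p⁽¹⁾ₖ₊₁(n, 2) + p⁽¹⁾ₖ(n − 1, 2), and unrolling it down to k = 0 gives the
-- alternating sum. Counts are compared through bijections between the enumerated candidate lists.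
module Submission where

open import Defs
open import Data.Nat using (ℕ; zero; suc; _+_; _∸_; _≤_; _<_; z≤n; s≤s; _≤?_)
import Data.Nat.Properties as ℕP
open import Data.Fin using (Fin; zero; suc; toℕ; inject₁; fromℕ) renaming (_<_ to _<ᶠ_)
open import Data.Fin.Properties using (toℕ-inject₁; toℕ-fromℕ; inject₁ℕ<; ≤fromℕ)
open import Data.Fin.Relation.Unary.Top using (view; ‵fromℕ; ‵inj₁)
open import Data.Vec using (Vec; []; _∷_; lookup; _∷ʳ_; init; initLast)
import Data.Vec as Vec
open import Data.Vec.Properties using (∷-injective; init-∷ʳ)
open import Function using (id)
open import Data.List using (List; []; _∷_; length; filter)
open import Data.List.Membership.Propositional using (_∈_)
open import Data.List.Membership.Propositional.Properties
  using (∈-filter⁺; ∈-filter⁻; ∈-upTo⁺; ∈-cartesianProductWith⁺)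
open import Data.List.Relation.Unary.Any using (here; there)
open import Data.List.Relation.Unary.All as All using ()
open import Data.List.Relation.Unary.AllPairs as AllPairs using (_∷_)
open import Data.List.Relation.Unary.Unique.Propositional using (Unique)
import Data.List.Relation.Unary.Unique.Propositional.Properties as Unique
open import Data.List.Properties using (filter-none)
open import Algebra.Properties.CommutativeSemigroup ℕP.+-commutativeSemigroup using (x∙yz≈y∙xz)
open import Data.Integer as ℤ using (ℤ; +_; -[1+_]; _-_; _*_)
import Data.Integer.Properties as ℤP
open import Algebra.Properties.AbelianGroup ℤP.+-0-abelianGroup using (//-rightDividesʳ)
open import Data.Product using (_×_; _,_; proj₂)
open import Data.Empty using (⊥-elim)
open import Relation.Nullary using (¬_; yes; no)
open import Level using (0ℓ)
open import Relation.Unary using (Pred; Decidable)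
open import Relation.Unary.Properties using (_∩?_; ∁?)
open import Relation.Binary.PropositionalEquality

module _ {B : Set} where

  remove : {y : B} {ys : List B} → y ∈ ys → List B
  remove {ys = _ ∷ ys} (here _)  = ys
  remove {ys = y ∷ ys} (there p) = y ∷ remove p

  length-remove : {y : B} {ys : List B} (p : y ∈ ys) → suc (length (remove p)) ≡ length ys
  length-remove (here _)  = refl
  length-remove (there p) = cong suc (length-remove p)

  ∈-remove : {y z : B} {ys : List B} (p : y ∈ ys) → z ∈ ys → z ≢ y → z ∈ remove p
  ∈-remove (here refl) (here refl) z≢y = ⊥-elim (z≢y refl)
  ∈-remove (here refl) (there q)   _   = q
  ∈-remove (there p)   (here z≡)   _   = here z≡
  ∈-remove (there p)   (there q)   z≢y = there (∈-remove p q z≢y)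

length-≤-injection : {A B : Set} (f : A → B) {xs : List A} {ys : List B} → Unique xs →
  (∀ {a b} → a ∈ xs → b ∈ xs → f a ≡ f b → a ≡ b) →
  (∀ {a} → a ∈ xs → f a ∈ ys) → length xs ≤ length ys
length-≤-injection f {[]}     _            _   _    = z≤n
length-≤-injection f {x ∷ xs} (x∉xs ∷ !xs) inj maps =
  subst (suc (length xs) ≤_) (length-remove fx∈ys)
    (s≤s (length-≤-injection f !xs
      (λ a∈ b∈ → inj (there a∈) (there b∈))
      (λ a∈ → ∈-remove fx∈ys (maps (there a∈))
         (λ fa≡fx → All.lookup x∉xs a∈ (sym (inj (there a∈) (here refl) fa≡fx))))))
  where fx∈ys = maps (here refl)

length-filter-≤ : {A B : Set} {P : Pred A 0ℓ} {Q : Pred B 0ℓ} (P? : Decidable P) (Q? : Decidable Q)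
  (f : A → B) {xs : List A} {ys : List B} → Unique xs →
  (∀ {b} → Q b → b ∈ ys) → (∀ {a} → P a → Q (f a)) →
  (∀ {a b} → P a → P b → f a ≡ f b → a ≡ b) →
  length (filter P? xs) ≤ length (filter Q? ys)
length-filter-≤ {P = P} P? Q? f {xs} !xs ys-complete f-maps f-inj =
  length-≤-injection f (Unique.filter⁺ P? !xs)
    (λ a∈ b∈ → f-inj (satisfies a∈) (satisfies b∈))
    (λ a∈ → let Qfa = f-maps (satisfies a∈) in ∈-filter⁺ Q? (ys-complete Qfa) Qfa)
  where
  satisfies : ∀ {a} → a ∈ filter P? xs → P a
  satisfies a∈ = proj₂ (∈-filter⁻ P? {xs = xs} a∈)

length-filter-≡ : {A B : Set} {P : Pred A 0ℓ} {Q : Pred B 0ℓ} (P? : Decidable P) (Q? : Decidable Q)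
  (f : A → B) (g : B → A) {xs : List A} {ys : List B} →
  Unique xs → Unique ys → (∀ {a} → P a → a ∈ xs) → (∀ {b} → Q b → b ∈ ys) →
  (∀ {a} → P a → Q (f a)) → (∀ {b} → Q b → P (g b)) →
  (∀ {a} → P a → g (f a) ≡ a) → (∀ {b} → Q b → f (g b) ≡ b) →
  length (filter P? xs) ≡ length (filter Q? ys)
length-filter-≡ P? Q? f g !xs !ys xs-complete ys-complete f-maps g-maps gf≡ fg≡ = ℕP.≤-antisym
  (length-filter-≤ P? Q? f !xs ys-complete f-maps
    (λ Pa Pb fa≡fb → trans (sym (gf≡ Pa)) (trans (cong g fa≡fb) (gf≡ Pb))))
  (length-filter-≤ Q? P? g !ys xs-complete g-maps
    (λ Qa Qb ga≡gb → trans (sym (fg≡ Qa)) (trans (cong f ga≡gb) (fg≡ Qb))))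

length-filter-∩-∁ : {A : Set} {P Q : Pred A 0ℓ} (P? : Decidable P) (Q? : Decidable Q) (xs : List A) →
  length (filter P? xs) ≡ length (filter (P? ∩? Q?) xs) + length (filter (P? ∩? ∁? Q?) xs)
length-filter-∩-∁ P? Q? []       = refl
length-filter-∩-∁ P? Q? (x ∷ xs) with P? x | Q? x
... | no _  | _     = length-filter-∩-∁ P? Q? xs
... | yes _ | yes _ = cong suc (length-filter-∩-∁ P? Q? xs)
... | yes _ | no _  = trans (cong suc (length-filter-∩-∁ P? Q? xs)) (sym (ℕP.+-suc _ _))

lookup≤sum : {k : ℕ} (v : Vec ℕ k) (i : Fin k) → lookup v i ≤ Vec.sum v
lookup≤sum (x ∷ v) zero    = ℕP.m≤m+n x _
lookup≤sum (x ∷ v) (suc i) = ℕP.≤-trans (lookup≤sum v i) (ℕP.m≤n+m _ x)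

sum-∷ʳ : {k : ℕ} (w : Vec ℕ k) (x : ℕ) → Vec.sum (w ∷ʳ x) ≡ x + Vec.sum w
sum-∷ʳ []      x = refl
sum-∷ʳ (y ∷ w) x = trans (cong (_+_ y) (sum-∷ʳ w x)) (x∙yz≈y∙xz y x (Vec.sum w))

module _ {A : Set} where

  lookup-∷ʳ-inject₁ : {k : ℕ} (w : Vec A k) (x : A) (i : Fin k) →
    lookup (w ∷ʳ x) (inject₁ i) ≡ lookup w i
  lookup-∷ʳ-inject₁ (y ∷ w) x zero    = refl
  lookup-∷ʳ-inject₁ (y ∷ w) x (suc i) = lookup-∷ʳ-inject₁ w x i

  lookup-∷ʳ-fromℕ : {k : ℕ} (w : Vec A k) (x : A) → lookup (w ∷ʳ x) (fromℕ k) ≡ x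
  lookup-∷ʳ-fromℕ []      x = refl
  lookup-∷ʳ-fromℕ (y ∷ w) x = lookup-∷ʳ-fromℕ w x

  init-∷ʳ-lookup-fromℕ : {k : ℕ} (v : Vec A (suc k)) → init v ∷ʳ lookup v (fromℕ k) ≡ v
  init-∷ʳ-lookup-fromℕ v with initLast v
  ... | w , x , refl = cong (w ∷ʳ_) (lookup-∷ʳ-fromℕ w x)

inject₁-mono-< : {k : ℕ} {i j : Fin k} → i <ᶠ j → inject₁ i <ᶠ inject₁ j
inject₁-mono-< {i = i} {j} i<j rewrite toℕ-inject₁ i | toℕ-inject₁ j = i<j

inject₁-cancel-< : {k : ℕ} {i j : Fin k} → inject₁ i <ᶠ inject₁ j → i <ᶠ j
inject₁-cancel-< {i = i} {j} i<j rewrite toℕ-inject₁ i | toℕ-inject₁ j = i<j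

inject₁<fromℕ : {k : ℕ} (i : Fin k) → inject₁ i <ᶠ fromℕ k
inject₁<fromℕ {k} i = subst (toℕ (inject₁ i) <_) (sym (toℕ-fromℕ k)) (inject₁ℕ< i)

fromℕ≮ : {k : ℕ} (j : Fin (suc k)) → ¬ fromℕ k <ᶠ j
fromℕ≮ j fromℕ<j = ℕP.<⇒≱ fromℕ<j (≤fromℕ j)

module _ {A : Set} {k : ℕ} (w : Vec A k) (x : A) where

  ∀-∷ʳ⁺ : {P : A → Set} → (∀ i → P (lookup w i)) → P x → ∀ i → P (lookup (w ∷ʳ x) i)
  ∀-∷ʳ⁺ {P} Pw Px i with view i
  ... | ‵fromℕ          = subst P (sym (lookup-∷ʳ-fromℕ w x)) Px
  ... | ‵inj₁ {i = j} _ = subst P (sym (lookup-∷ʳ-inject₁ w x j)) (Pw j)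

  ∀-∷ʳ⁻ : {P : A → Set} → (∀ i → P (lookup (w ∷ʳ x) i)) → ∀ i → P (lookup w i)
  ∀-∷ʳ⁻ {P} P[w∷ʳx] i = subst P (lookup-∷ʳ-inject₁ w x i) (P[w∷ʳx] (inject₁ i))

  ∀-<-∷ʳ⁻ : {R : A → A → Set} → (∀ i j → i <ᶠ j → R (lookup (w ∷ʳ x) j) (lookup (w ∷ʳ x) i)) →
    ∀ i j → i <ᶠ j → R (lookup w j) (lookup w i)
  ∀-<-∷ʳ⁻ {R} R[w∷ʳx] i j i<j = subst₂ R (lookup-∷ʳ-inject₁ w x j) (lookup-∷ʳ-inject₁ w x i)
    (R[w∷ʳx] (inject₁ i) (inject₁ j) (inject₁-mono-< i<j))

boundedVecs-unique : (m k : ℕ) → Unique (boundedVecs m k)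
boundedVecs-unique m zero    = All.[] ∷ AllPairs.[]
boundedVecs-unique m (suc k) =
  Unique.cartesianProductWith⁺ _∷_ ∷-injective (Unique.upTo⁺ (suc m)) (boundedVecs-unique m k)

∈-boundedVecs : (m : ℕ) {k : ℕ} (v : Vec ℕ k) → (∀ i → lookup v i ≤ m) → v ∈ boundedVecs m k
∈-boundedVecs m []      _   = here refl
∈-boundedVecs m (x ∷ v) v≤m =
  ∈-cartesianProductWith⁺ _∷_ (∈-upTo⁺ (s≤s (v≤m zero))) (∈-boundedVecs m v (λ i → v≤m (suc i)))

module _ {d r m k : ℕ} (v : Vec ℕ k) where

  partition∈boundedVecs : IsDistantPartition d r m k v → v ∈ boundedVecs m k
  partition∈boundedVecs (_ , _ , _ , _ , sum≡m) =
    ∈-boundedVecs m v (λ i → subst (lookup v i ≤_) sum≡m (lookup≤sum v i))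

  withLowerBound : {r′ : ℕ} → IsDistantPartition d r m k v → (∀ i → r′ ≤ lookup v i) →
    IsDistantPartition d r′ m k v
  withLowerBound (dec , pos , _ , dist , sum≡m) low′ = dec , pos , low′ , dist , sum≡m

lookup-fromℕ-minimal : {d r m k : ℕ} (v : Vec ℕ (suc k)) → IsDistantPartition d r m (suc k) v →
  ∀ i → lookup v (fromℕ k) ≤ lookup v i
lookup-fromℕ-minimal {k = k} v (dec , _) i with view i
... | ‵fromℕ          = ℕP.≤-refl
... | ‵inj₁ {i = j} _ = dec (inject₁ j) (fromℕ k) (inject₁<fromℕ j)

no-partition-of-zero : {d r k : ℕ} (v : Vec ℕ (suc k)) → ¬ IsDistantPartition d r 0 (suc k) v
no-partition-of-zero v (_ , pos , _ , _ , sum≡0) =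
  ℕP.<⇒≱ (pos zero) (subst (lookup v zero ≤_) sum≡0 (lookup≤sum v zero))

module _ {d r s k : ℕ} (w : Vec ℕ k) (x : ℕ) where

  IsDistantPartition-∷ʳ⁺ : IsDistantPartition d r s k w → 1 ≤ x → r ≤ x → (∀ i → x + d ≤ lookup w i) →
    IsDistantPartition d r (x + s) (suc k) (w ∷ʳ x)
  IsDistantPartition-∷ʳ⁺ (_ , pos , low , dist , sum≡s) 1≤x r≤x x+d≤w =
    (λ i j i<j → ℕP.m+n≤o⇒m≤o _ (dist′ i j i<j)) ,
    ∀-∷ʳ⁺ w x {1 ≤_} pos 1≤x , ∀-∷ʳ⁺ w x {r ≤_} low r≤x , dist′ ,
    trans (sum-∷ʳ w x) (cong (_+_ x) sum≡s)
    where
    dist′ : ∀ i j → i <ᶠ j → lookup (w ∷ʳ x) j + d ≤ lookup (w ∷ʳ x) i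
    dist′ i j i<j with view i | view j
    ... | ‵fromℕ          | _ = ⊥-elim (fromℕ≮ j i<j)
    ... | ‵inj₁ {i = a} _ | ‵fromℕ
      rewrite lookup-∷ʳ-inject₁ w x a | lookup-∷ʳ-fromℕ w x = x+d≤w a
    ... | ‵inj₁ {i = a} _ | ‵inj₁ {i = b} _
      rewrite lookup-∷ʳ-inject₁ w x a | lookup-∷ʳ-inject₁ w x b = dist a b (inject₁-cancel-< i<j)

  IsDistantPartition-∷ʳ⁻ : IsDistantPartition d r (x + s) (suc k) (w ∷ʳ x) →
    IsDistantPartition d r s k w × (∀ i → x + d ≤ lookup w i)
  IsDistantPartition-∷ʳ⁻ (dec , pos , low , dist , sum≡x+s) =
    (∀-<-∷ʳ⁻ w x {_≤_} dec , ∀-∷ʳ⁻ w x {1 ≤_} pos , ∀-∷ʳ⁻ w x {r ≤_} low ,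
     ∀-<-∷ʳ⁻ w x {λ a b → a + d ≤ b} dist ,
     ℕP.+-cancelˡ-≡ x _ _ (trans (sym (sum-∷ʳ w x)) sum≡x+s)) ,
    λ i → subst₂ (λ a b → a + d ≤ b) (lookup-∷ʳ-fromℕ w x) (lookup-∷ʳ-inject₁ w x i)
            (dist (inject₁ i) (fromℕ k) (inject₁<fromℕ i))

module _ (d : ℕ) where

  pℕ-lowerBound-cong : {k m r r′ : ℕ} →
    (∀ v → IsDistantPartition d r m k v → ∀ i → r′ ≤ lookup v i) →
    (∀ v → IsDistantPartition d r′ m k v → ∀ i → r ≤ lookup v i) →
    pℕ d k m r ≡ pℕ d k m r′
  pℕ-lowerBound-cong {k} {m} {r} {r′} r′≤ r≤ =
    length-filter-≡ (isDistantPartition? d r m k) (isDistantPartition? d r′ m k) id id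
      (boundedVecs-unique m k) (boundedVecs-unique m k)
      (λ {v} → partition∈boundedVecs v) (λ {v} → partition∈boundedVecs v)
      (λ {v} P → withLowerBound v P (r′≤ v P)) (λ {v} Q → withLowerBound v Q (r≤ v Q))
      (λ _ → refl) (λ _ → refl)

  pℕ-no-parts : (m r r′ : ℕ) → pℕ d 0 m r ≡ pℕ d 0 m r′
  pℕ-no-parts m r r′ = pℕ-lowerBound-cong {0} {m} {r} {r′} (λ _ _ ()) (λ _ _ ())

  pℕ-positive : (k m : ℕ) → pℕ d k m 0 ≡ pℕ d k m 1
  pℕ-positive k m = pℕ-lowerBound-cong {k} {m} (λ _ (_ , pos , _) → pos) (λ _ _ _ → z≤n)

  pℕ-of-zero : (k r : ℕ) → pℕ d (suc k) 0 r ≡ 0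
  pℕ-of-zero k r = cong length
    (filter-none (isDistantPartition? d r 0 (suc k)) {boundedVecs 0 (suc k)}
      (All.tabulate (λ {v} _ → no-partition-of-zero v)))

smallestPart≥? : (r k : ℕ) → Decidable (λ (v : Vec ℕ (suc k)) → r ≤ lookup v (fromℕ k))
smallestPart≥? r k v = r ≤? lookup v (fromℕ k)

module _ (d k : ℕ) where

  count-smallestPart> : (m r : ℕ) →
    length (filter (isDistantPartition? d r m (suc k) ∩? smallestPart≥? (suc r) k) (boundedVecs m (suc k)))
      ≡ pℕ d (suc k) m (suc r)
  count-smallestPart> m r =
    length-filter-≡ _ (isDistantPartition? d (suc r) m (suc k)) id id
      (boundedVecs-unique m (suc k)) (boundedVecs-unique m (suc k))
      (λ {v} (P , _) → partition∈boundedVecs v P) (λ {v} → partition∈boundedVecs v)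
      (λ {v} (P , r<x) → withLowerBound v P (λ i → ℕP.≤-trans r<x (lookup-fromℕ-minimal v P i)))
      (λ {v} Q@(_ , _ , low , _) →
         withLowerBound v Q (λ i → ℕP.≤-trans (ℕP.n≤1+n r) (low i)) , low (fromℕ k))
      (λ _ → refl) (λ _ → refl)

  smallestPart≡ : {r m : ℕ} (v : Vec ℕ (suc k)) → IsDistantPartition d (suc r) m (suc k) v →
    ¬ suc (suc r) ≤ lookup v (fromℕ k) → init v ∷ʳ suc r ≡ v
  smallestPart≡ {r} v (_ , _ , low , _) ¬r<x = begin
    init v ∷ʳ suc r                ≡⟨ cong (init v ∷ʳ_) 1+r≡x ⟩
    init v ∷ʳ lookup v (fromℕ k)   ≡⟨ init-∷ʳ-lookup-fromℕ v ⟩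
    v                              ∎
    where
    open ≡-Reasoning
    1+r≡x : suc r ≡ lookup v (fromℕ k)
    1+r≡x = ℕP.≤-antisym (low (fromℕ k)) (ℕP.≤-pred (ℕP.≰⇒> ¬r<x))

  count-smallestPart≡ : (r s : ℕ) →
    length (filter (isDistantPartition? d (suc r) (suc r + s) (suc k) ∩? ∁? (smallestPart≥? (suc (suc r)) k))
                   (boundedVecs (suc r + s) (suc k)))
      ≡ pℕ d k s (suc r + d)
  count-smallestPart≡ r s =
    length-filter-≡ _ (isDistantPartition? d (suc r + d) s k) init (_∷ʳ suc r)
      (boundedVecs-unique (suc r + s) (suc k)) (boundedVecs-unique s k)
      (λ {v} (P , _) → partition∈boundedVecs v P) (λ {w} → partition∈boundedVecs w)
      (λ {v} → removeSmallest {v}) (λ {w} → addSmallest {w})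
      (λ {v} (P , ¬r<x) → smallestPart≡ v P ¬r<x) (λ {w} _ → init-∷ʳ (suc r) w)
    where
    removeSmallest : ∀ {v} →
      IsDistantPartition d (suc r) (suc r + s) (suc k) v × ¬ suc (suc r) ≤ lookup v (fromℕ k) →
      IsDistantPartition d (suc r + d) s k (init v)
    removeSmallest {v} (P , ¬r<x) =
      let (Pw , r+d≤w) = IsDistantPartition-∷ʳ⁻ (init v) (suc r)
                           (subst (IsDistantPartition d (suc r) (suc r + s) (suc k))
                                  (sym (smallestPart≡ v P ¬r<x)) P)
      in withLowerBound (init v) Pw r+d≤w
    addSmallest : ∀ {w} → IsDistantPartition d (suc r + d) s k w →
      IsDistantPartition d (suc r) (suc r + s) (suc k) (w ∷ʳ suc r) ×
      ¬ suc (suc r) ≤ lookup (w ∷ʳ suc r) (fromℕ k)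
    addSmallest {w} Q@(_ , _ , low , _) =
      IsDistantPartition-∷ʳ⁺ w (suc r)
        (withLowerBound w Q (λ i → ℕP.≤-trans (ℕP.m≤m+n (suc r) d) (low i))) (s≤s z≤n) ℕP.≤-refl low ,
      λ r<x → ℕP.n≮n (suc r) (subst (suc (suc r) ≤_) (lookup-∷ʳ-fromℕ w (suc r)) r<x)

  pℕ-smallestPart : (r s : ℕ) →
    pℕ d (suc k) (suc r + s) (suc r) ≡ pℕ d (suc k) (suc r + s) (suc (suc r)) + pℕ d k s (suc r + d)
  pℕ-smallestPart r s =
    trans (length-filter-∩-∁ (isDistantPartition? d (suc r) (suc r + s) (suc k))
                             (smallestPart≥? (suc (suc r)) k) (boundedVecs (suc r + s) (suc k)))
          (cong₂ _+_ (count-smallestPart> (suc r + s) (suc r)) (count-smallestPart≡ r s))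

Σ-cong : (k : ℕ) {f g : ℕ → ℤ} → (∀ i → f i ≡ g i) → Σ[0≤i≤ k ] f ≡ Σ[0≤i≤ k ] g
Σ-cong zero    f≡g = f≡g 0
Σ-cong (suc k) f≡g = cong₂ ℤ._+_ (Σ-cong k f≡g) (f≡g (suc k))

Σ-suc : (k : ℕ) (f : ℕ → ℤ) → Σ[0≤i≤ suc k ] f ≡ f 0 ℤ.+ Σ[0≤i≤ k ] (λ i → f (suc i))
Σ-suc zero    f = refl
Σ-suc (suc k) f = trans (cong (ℤ._+ f (suc (suc k))) (Σ-suc k f)) (ℤP.+-assoc (f 0) _ _)

Σ-neg : (k : ℕ) (f : ℕ → ℤ) → Σ[0≤i≤ k ] (λ i → ℤ.- f i) ≡ ℤ.- Σ[0≤i≤ k ] f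
Σ-neg zero    f = refl
Σ-neg (suc k) f =
  trans (cong (ℤ._+ ℤ.- f (suc k)) (Σ-neg k f)) (sym (ℤP.neg-distrib-+ (Σ[0≤i≤ k ] f) (f (suc k))))

leading-term : (z : ℕ → ℤ → ℤ) (k : ℕ) (n : ℤ) → z k n ≡ sign 0 * z (k ∸ 0) (n - + 0)
leading-term z k n = sym (trans (ℤP.*-identityˡ _) (cong (z k) (ℤP.+-identityʳ n)))

minus-suc : (n : ℤ) (i : ℕ) → n - + suc i ≡ (n - + 1) - + i
minus-suc n i = trans (cong (ℤ._+_ n) (ℤP.neg-distrib-+ (+ 1) (+ i))) (sym (ℤP.+-assoc n _ _))

module _ (q z : ℕ → ℤ → ℤ) (q₀≡z₀ : ∀ n → q 0 n ≡ z 0 n)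
         (z-split : ∀ k n → z (suc k) n ≡ q (suc k) n ℤ.+ q k (n - + 1)) where

  alternating-inversion : ∀ k n → q k n ≡ Σ[0≤i≤ k ] (λ i → sign i * z (k ∸ i) (n - + i))
  alternating-inversion zero    n = trans (q₀≡z₀ n) (leading-term z 0 n)
  alternating-inversion (suc k) n = begin
    q (suc k) n                                       ≡⟨ //-rightDividesʳ (q k (n - + 1)) (q (suc k) n) ⟨
    (q (suc k) n ℤ.+ q k (n - + 1)) - q k (n - + 1)   ≡⟨ cong₂ _-_ (sym (z-split k n)) ih ⟩
    z (suc k) n - Σ[0≤i≤ k ] g                        ≡⟨ cong (_- Σ[0≤i≤ k ] g) (leading-term z (suc k) n) ⟩
    f 0 - Σ[0≤i≤ k ] g                                ≡⟨ cong (ℤ._+_ (f 0)) (Σ-neg k g) ⟨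
    f 0 ℤ.+ Σ[0≤i≤ k ] (λ i → ℤ.- g i)                ≡⟨ cong (ℤ._+_ (f 0)) (Σ-cong k f[1+i]≡-g[i]) ⟨
    f 0 ℤ.+ Σ[0≤i≤ k ] (λ i → f (suc i))              ≡⟨ Σ-suc k f ⟨
    Σ[0≤i≤ suc k ] f                                  ∎
    where
    open ≡-Reasoning
    f g : ℕ → ℤ
    f i = sign i * z (suc k ∸ i) (n - + i)
    g i = sign i * z (k ∸ i) ((n - + 1) - + i)
    ih : q k (n - + 1) ≡ Σ[0≤i≤ k ] g
    ih = alternating-inversion k (n - + 1)
    f[1+i]≡-g[i] : ∀ i → f (suc i) ≡ ℤ.- g i
    f[1+i]≡-g[i] i = trans (cong (λ m → ℤ.- sign i * z (k ∸ i) m) (minus-suc n i))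
                           (sym (ℤP.neg-distribˡ-* (sign i) _))

p-no-parts : (n : ℤ) → + pr 1 0 n 2 ≡ + p 1 0 n
p-no-parts (+ m)    = cong +_ (pℕ-no-parts 1 m 2 0)
p-no-parts -[1+ _ ] = refl

p-smallestPart : (k : ℕ) (n : ℤ) → + p 1 (suc k) n ≡ + pr 1 (suc k) n 2 ℤ.+ + pr 1 k (n - + 1) 2
p-smallestPart k (+ zero)  rewrite pℕ-of-zero 1 k 0 | pℕ-of-zero 1 k 2 = refl
p-smallestPart k (+ suc m) = cong +_ (trans (pℕ-positive 1 (suc k) (suc m)) (pℕ-smallestPart 1 k 0 m))
p-smallestPart k -[1+ _ ]  = refl

proposition1 : (k : ℕ) (n : ℤ) →
    + pr 1 k n 2 ≡ Σ[0≤i≤ k ] (λ i → sign i * + p 1 (k ∸ i) (n - + i))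
proposition1 = alternating-inversion (λ k n → + pr 1 k n 2) (λ k n → + p 1 k n) p-no-parts p-smallestPart
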